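{- Let $r,n$ be positive integers and $p,p',q,q'$ positive divisors of $r$ with $pq=p'q'$ dividing $rn$. Assume $\mathrm{GCD}(p,n)=\mathrm{GCD}(p',n)$ and $\mathrm{GCD}(q,n)=\mathrm{GCD}(q',n)$. Call a prime special if it appears with different multiplicities in the prime factorizations of $p$ and $p'$. Write $\frac{rn}{pq}=\eta\delta$, where $\eta$ is a positive integer all of whose prime factors are non-special and $\delta$ is a positive integer all of whose prime factors are special. Then $\delta p$ divides $r$ and $\delta pq$ divides $rn$ (so $G(r,\delta p,q,n)$ is well-defined), and $G(r,p,q,n)\cong G(r,\delta p,q,n)\times\mathbb{Z}_\delta$.
   Context: For a positive integer $r$ let $\zeta_r=\exp(2\pi\sqrt{ -1}/r)$ and $\mathbb{Z}_r=\mathbb{Z}/r\mathbb{Z}$ (the cyclic group of order $r$). $G(r,n)$ is the group of $n\times n$ complex matrices with exactly one nonzero entry in each row and column, each nonzero entry an $r$th root of unity; its elements are written $(\pi,x)$ with $\pi\in S_n$, $x\in(\mathbb{Z}_r)^n$, meaning the matrix whose $i$th column has $\zeta_r^{x_i}$ in row $\pi(i)$. Put $\Delta(\pi,x)=\sum_i x_i$. For $p\mid r$, $G(r,p,n)=\{g\in G(r,n):\Delta(g)\in p\mathbb{Z}_r\}$. With $c=\zeta_rI_n$, when $p,q\mid r$ and $pq\mid rn$ the group $C_q=\langle c^{r/q}\rangle$ is central of order $q$ in $G(r,p,n)$ and $G(r,p,q,n):=G(r,p,n)/C_q$. -}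

module Defs where

open import Level using (0ℓ)
open import Data.Nat using (ℕ; zero; suc; _+_; _*_; _^_; NonZero)
open import Data.Nat.DivMod using (_/_; _%_)
open import Data.Nat.Divisibility using (_∣_)
open import Data.Nat.Primality using (Prime)
open import Data.Fin using (Fin)
import Data.Fin as F
open import Data.Fin.Permutation using (Permutation′; _⟨$⟩ʳ_; _∘ₚ_)
open import Data.Product using (Σ; ∃; _×_; _,_; proj₁; proj₂)
open import Relation.Binary.PropositionalEquality using (_≡_; _≢_)
open import Relation.Nullary using (¬_)
open import Algebra.Bundles.Raw using (RawMagma)
open import Algebra.Morphism.Structures using (module MagmaMorphisms)
open import Data.Nat.Properties using (+-0-commutativeMonoid)
import Algebra.Properties.CommutativeMonoid.Sum as SumProps
module ΣN = SumProps +-0-commutativeMonoid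
open import Data.Nat.Divisibility using (∣m∣n⇒∣m+n)
open import Relation.Binary.PropositionalEquality using (subst; sym; cong₂)

sumF : ∀ {n} → (Fin n → ℕ) → ℕ
sumF = ΣN.sum

-- An element (π , x) of G(r,n): π ∈ S_n, x ∈ (ℤ_r)^n, where the entries of
-- x are represented by natural numbers and compared modulo r.
-- (π , x) is the matrix whose i-th column has ζ_r^{x_i} in row π(i).
record Mon (n : ℕ) : Set where
  constructor mon
  field
    perm : Permutation′ n
    vec  : Fin n → ℕ
open Mon public

Δ : ∀ {n} → Mon n → ℕ
Δ g = sumF (vec g)

-- matrix product: (π , x)(σ , y) = (π ∘ σ , i ↦ x_{σ(i)} + y_i)
_·_ : ∀ {n} → Mon n → Mon n → Mon n
mon π x · mon σ y = mon (σ ∘ₚ π) (λ i → x (σ ⟨$⟩ʳ i) + y i)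

-- G(r,p,n) = { g ∈ G(r,n) : Δ(g) ∈ pℤ_r }; for p ∣ r this is p ∣ Δ(g)
-- for any natural-number representative.
GElem : (r p n : ℕ) → Set
GElem r p n = Σ (Mon n) λ g → p ∣ Δ g

-- G(r,p,q,n) = G(r,p,n)/C_q with C_q = ⟨ c^{r/q} ⟩, c = ζ_r I_n:
-- g ~ h iff g = h · c^{(r/q) k} for some k, i.e. same permutation and
-- x_i ≡ y_i + k (r/q)  (mod r) for all i.
Gpq : (r p q n : ℕ) → .{{NonZero r}} → .{{NonZero q}} → RawMagma 0ℓ 0ℓ
Gpq r p q n = record
  { Carrier = GElem r p n
  ; _≈_ = λ g h →
      (∀ i → perm (proj₁ g) ⟨$⟩ʳ i ≡ perm (proj₁ h) ⟨$⟩ʳ i)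
      × ∃ λ k → ∀ i → vec (proj₁ g) i % r ≡ (vec (proj₁ h) i + k * (r / q)) % r
  ; _∙_ = λ g h → (proj₁ g · proj₁ h) , mulDiv g h
  }
  where
  mulDiv : (g h : GElem r p n) → p ∣ Δ (proj₁ g · proj₁ h)
  mulDiv (mon π x , d) (mon σ y , e) =
    subst (p ∣_) (sym (ΣN.∑-distrib-+ (λ i → x (σ ⟨$⟩ʳ i)) y))
      (subst (λ s → p ∣ s + sumF y) (ΣN.sum-permute x σ) (∣m∣n⇒∣m+n d e))

_×ℤ_ : RawMagma 0ℓ 0ℓ → (δ : ℕ) → .{{NonZero δ}} → RawMagma 0ℓ 0ℓ
G ×ℤ δ = record
  { Carrier = RawMagma.Carrier G × ℕ
  ; _≈_ = λ u v → RawMagma._≈_ G (proj₁ u) (proj₁ v) × proj₂ u % δ ≡ proj₂ v % δ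
  ; _∙_ = λ u v → RawMagma._∙_ G (proj₁ u) (proj₁ v) , proj₂ u + proj₂ v
  }

_≅_ : RawMagma 0ℓ 0ℓ → RawMagma 0ℓ 0ℓ → Set
G ≅ H = let open MagmaMorphisms G H in
  ∃ λ (f : RawMagma.Carrier G → RawMagma.Carrier H) →
  IsMagmaIsomorphism f

Mult : ℕ → ℕ → ℕ → Set
Mult ℓ k m = (ℓ ^ k ∣ m) × ¬ (ℓ ^ suc k ∣ m)

Special : ℕ → ℕ → ℕ → Set
Special p p' ℓ = Prime ℓ × ∃ λ k → ∃ λ k' → Mult ℓ k p × Mult ℓ k' p' × k ≢ k'

-- Let Q = r / q, so that C_q is generated by c^Q, and χ(g) = Δ(g)/p mod δ.
-- Given an exponent A with δp ∣ An + p and Q ∣ Aδ, the map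
-- g ↦ (g · c^{A χ(g)}, χ(g)) is an isomorphism G(r,p,q,n) ≅ G(r,δp,q,n) × ℤ_δ:
-- the twist adds A χ(g) n to Δ, which makes Δ divisible by δp; χ is well defined
-- on C_q-cosets because δp ∣ nQ; and the twists of a product differ from the
-- twist of the product by a power of c^Q because Q ∣ Aδ.
-- An exponent A = L t with L = Q / gcd(Q, δ) exists by Bézout once
-- gcd(Ln, δp) ∣ p. This, and δp ∣ r, are checked one prime at a time: at a
-- prime dividing δ the multiplicities of p and p′ differ, so the gcd conditions
-- force the multiplicity of n to be at most those of p and q, and the prime
-- does not divide η.

module Submission where

open import Defs
open import Level using (0ℓ)
open import Algebra.Bundles.Raw using (RawMagma)
open import Data.Fin using (Fin)
import Data.Fin as F
open import Data.Fin.Permutation using (_⟨$⟩ʳ_)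
open import Data.List.Base using ([]; _∷_)
open import Data.Nat
open import Data.Nat.Properties
open import Algebra.Properties.CommutativeSemigroup +-commutativeSemigroup
  using () renaming (interchange to +-interchange; xy∙z≈xz∙y to +-right-comm; x∙yz≈xz∙y to +-shuffle)
open import Algebra.Properties.CommutativeSemigroup *-commutativeSemigroup
  using () renaming (interchange to *-interchange; xy∙z≈xz∙y to *-right-comm)
open import Data.Nat.DivMod
open import Data.Nat.Divisibility
open import Data.Nat.GCD
open import Data.Nat.ListAction using (product)
open import Data.Nat.Primality
  using (Prime; prime⇒nonZero; prime⇒nonTrivial; euclidsLemma; productOfPrimes≢0)
open import Data.Nat.Primality.Factorisation using (factorise; module PrimeFactorisation)
open import Data.Nat.Induction using (<-wellFounded)
open import Induction.WellFounded using (Acc; acc)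
open import Data.List.Relation.Unary.All as All using (All)
open import Data.Sum using (inj₁; inj₂)
open import Data.Nat.Tactic.RingSolver using (solve)
open import Data.Product
open import Function using (_∘_)
open import Relation.Binary.PropositionalEquality
open import Relation.Nullary using (¬_; Dec; yes; no)
open import Relation.Nullary.Negation using (contradiction)

-- Congruences modulo r

infix 4 _≡_[mod_]
_≡_[mod_] : ℕ → ℕ → (r : ℕ) → .{{NonZero r}} → Set
_≡_[mod_] a b r = a % r ≡ b % r

module _ {r : ℕ} .{{_ : NonZero r}} where
  open ≡-Reasoning

  ≡[mod]-cong-+ʳ : ∀ {a b} c → a ≡ b [mod r ] → a + c ≡ b + c [mod r ]
  ≡[mod]-cong-+ʳ {a} {b} c a≡b = begin
    (a + c) % r          ≡⟨ %-distribˡ-+ a c r ⟩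
    (a % r + c % r) % r  ≡⟨ cong (λ t → (t + c % r) % r) a≡b ⟩
    (b % r + c % r) % r  ≡⟨ sym (%-distribˡ-+ b c r) ⟩
    (b + c) % r          ∎

  -- Adding c·(r − 1) is subtracting c modulo r.
  ≡[mod]-cancel-+ʳ : ∀ {a b} c → a + c ≡ b + c [mod r ] → a ≡ b [mod r ]
  ≡[mod]-cancel-+ʳ {a} {b} c a+c≡b+c = begin
    a % r                          ≡⟨ sym ([m+kn]%n≡m%n a c r) ⟩
    (a + c * r) % r                ≡⟨ cong (_% r) (unfold a) ⟩
    (a + c + c * pred r) % r       ≡⟨ ≡[mod]-cong-+ʳ (c * pred r) a+c≡b+c ⟩
    (b + c + c * pred r) % r       ≡⟨ cong (_% r) (sym (unfold b)) ⟩
    (b + c * r) % r                ≡⟨ [m+kn]%n≡m%n b c r ⟩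
    b % r                          ∎
    where
    unfold : ∀ x → x + c * r ≡ x + c + c * pred r
    unfold x = begin
      x + c * r                ≡⟨ cong (λ t → x + c * t) (sym (suc-pred r)) ⟩
      x + c * suc (pred r)     ≡⟨ cong (x +_) (*-suc c (pred r)) ⟩
      x + (c + c * pred r)     ≡⟨ sym (+-assoc x c _) ⟩
      x + c + c * pred r       ∎

  ≡[mod]-sumF : ∀ {m} (x y : Fin m → ℕ) → (∀ i → x i ≡ y i [mod r ]) → sumF x ≡ sumF y [mod r ]
  ≡[mod]-sumF {zero}  x y x≡y = refl
  ≡[mod]-sumF {suc m} x y x≡y = begin
    (x F.zero + sumF (x ∘ F.suc)) % r              ≡⟨ %-distribˡ-+ (x F.zero) _ r ⟩
    (x F.zero % r + sumF (x ∘ F.suc) % r) % r      ≡⟨ cong₂ (λ u v → (u + v) % r) (x≡y F.zero)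
                                                         (≡[mod]-sumF (x ∘ F.suc) (y ∘ F.suc) (x≡y ∘ F.suc)) ⟩
    (y F.zero % r + sumF (y ∘ F.suc) % r) % r      ≡⟨ sym (%-distribˡ-+ (y F.zero) _ r) ⟩
    (y F.zero + sumF (y ∘ F.suc)) % r              ∎

≡[mod]-∣ : ∀ {r d a b} .{{_ : NonZero r}} .{{_ : NonZero d}} →
           d ∣ r → a ≡ b [mod r ] → a ≡ b [mod d ]
≡[mod]-∣ {r} {d} {a} {b} d∣r a≡b = begin
  a % d      ≡⟨ sym (m∣n⇒o%n%m≡o%m d r a d∣r) ⟩
  a % r % d  ≡⟨ cong (_% d) a≡b ⟩
  b % r % d  ≡⟨ m∣n⇒o%n%m≡o%m d r b d∣r ⟩
  b % d      ∎
  where open ≡-Reasoning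

≡[mod*]⇒/≡[mod] : ∀ {p δ a b} .{{_ : NonZero p}} .{{_ : NonZero δ}} .{{_ : NonZero (δ * p)}} →
                   p ∣ a → p ∣ b → a ≡ b [mod δ * p ] → a / p ≡ b / p [mod δ ]
≡[mod*]⇒/≡[mod] {p} {δ} {a} {b} p∣a p∣b a≡b = *-cancelʳ-≡ _ _ p (begin
  a / p % δ * p            ≡⟨ m%n*o≡m*o%[n*o] (a / p) δ p ⟩
  a / p * p % (δ * p)      ≡⟨ cong (_% (δ * p)) (m/n*n≡m p∣a) ⟩
  a % (δ * p)              ≡⟨ a≡b ⟩
  b % (δ * p)              ≡⟨ cong (_% (δ * p)) (sym (m/n*n≡m p∣b)) ⟩
  b / p * p % (δ * p)      ≡⟨ sym (m%n*o≡m*o%[n*o] (b / p) δ p) ⟩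
  b / p % δ * p            ∎)
  where open ≡-Reasoning

sumF-+const : ∀ {m} (x : Fin m → ℕ) c → sumF (λ i → x i + c) ≡ sumF x + m * c
sumF-+const {zero}  x c = refl
sumF-+const {suc m} x c = begin
  x F.zero + c + sumF (λ i → x (F.suc i) + c)  ≡⟨ cong (x F.zero + c +_) (sumF-+const (x ∘ F.suc) c) ⟩
  x F.zero + c + (sumF (x ∘ F.suc) + m * c)    ≡⟨ +-interchange (x F.zero) c _ _ ⟩
  x F.zero + sumF (x ∘ F.suc) + (c + m * c)    ∎
  where open ≡-Reasoning

-- The splitting isomorphism

Δ-· : ∀ {n} (g h : Mon n) → Δ (g · h) ≡ Δ g + Δ h
Δ-· (mon π x) (mon σ y) =
  trans (ΣN.∑-distrib-+ (λ i → x (σ ⟨$⟩ʳ i)) y) (cong (_+ sumF y) (sym (ΣN.sum-permute x σ)))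

-- Multiplication by the scalar matrix ζ_r^c I_n.
scale : ∀ {n} → ℕ → Mon n → Mon n
scale c (mon π x) = mon π (λ i → x i + c)

Δ-scale : ∀ {n} c (g : Mon n) → Δ (scale c g) ≡ Δ g + n * c
Δ-scale c (mon π x) = sumF-+const x c

module CentralQuotient (r q : ℕ) .{{_ : NonZero r}} .{{_ : NonZero q}} (q∣r : q ∣ r) where
  open ≡-Reasoning

  Q : ℕ
  Q = r / q

  -- Modulo r = Q q, the negative of k Q is k (q − 1) Q.
  +k*Q+k*[q-1]*Q≡[mod] : ∀ a k → a + k * Q + k * pred q * Q ≡ a [mod r ]
  +k*Q+k*[q-1]*Q≡[mod] a k = begin
    (a + k * Q + k * pred q * Q) % r  ≡⟨ cong (_% r) (expand a k Q (pred q)) ⟩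
    (a + k * (Q * suc (pred q))) % r  ≡⟨ cong (λ t → (a + k * (Q * t)) % r) (suc-pred q) ⟩
    (a + k * (Q * q)) % r             ≡⟨ cong (λ t → (a + k * t) % r) (m/n*n≡m q∣r) ⟩
    (a + k * r) % r                   ≡⟨ [m+kn]%n≡m%n a k r ⟩
    a % r                             ∎
    where
    expand : ∀ a k Q m → a + k * Q + k * m * Q ≡ a + k * (Q * suc m)
    expand a k Q m = solve (a ∷ k ∷ Q ∷ m ∷ [])

  module _ {p n : ℕ} where
    open RawMagma (Gpq r p q n) using (_≈_)

    ≈-sym : ∀ {g h} → g ≈ h → h ≈ g
    ≈-sym {g , _} {h , _} (π≡σ , k , x≡y) = sym ∘ π≡σ , k * pred q , λ i → sym (begin
      (vec g i + k * pred q * Q) % r          ≡⟨ ≡[mod]-cong-+ʳ (k * pred q * Q) (x≡y i) ⟩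
      (vec h i + k * Q + k * pred q * Q) % r  ≡⟨ +k*Q+k*[q-1]*Q≡[mod] (vec h i) k ⟩
      vec h i % r                             ∎)

    ≈-trans : ∀ {g h w} → g ≈ h → h ≈ w → g ≈ w
    ≈-trans {g , _} {h , _} {w , _} (π≡σ , k , x≡y) (σ≡τ , l , y≡z) =
      (λ i → trans (π≡σ i) (σ≡τ i)) , k + l , λ i → begin
        vec g i % r                    ≡⟨ x≡y i ⟩
        (vec h i + k * Q) % r          ≡⟨ ≡[mod]-cong-+ʳ (k * Q) (y≡z i) ⟩
        (vec w i + l * Q + k * Q) % r  ≡⟨ cong (_% r) (+-assoc (vec w i) _ _) ⟩
        (vec w i + (l * Q + k * Q)) % r ≡⟨ cong (λ t → (vec w i + t) % r) (+-comm (l * Q) _) ⟩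
        (vec w i + (k * Q + l * Q)) % r ≡⟨ cong (λ t → (vec w i + t) % r) (sym (*-distribʳ-+ Q k l)) ⟩
        (vec w i + (k + l) * Q) % r    ∎

module Splitting
  (r n p q δ A : ℕ) .{{_ : NonZero r}} .{{_ : NonZero p}} .{{_ : NonZero q}} .{{_ : NonZero δ}}
  (q∣r : q ∣ r) (δp∣r : δ * p ∣ r) (δp∣nQ : δ * p ∣ n * (r / q))
  (Q∣Aδ : r / q ∣ A * δ) (δp∣An+p : δ * p ∣ A * n + p)
  where

  open CentralQuotient r q q∣r
  open ≡-Reasoning

  instance
    δ*p≢0 : NonZero (δ * p)
    δ*p≢0 = m*n≢0 δ p

  G₁ H G₂ : RawMagma 0ℓ 0ℓ
  G₁ = Gpq r p q n
  H = Gpq r (δ * p) q n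
  G₂ = H ×ℤ δ
  open RawMagma G₁ using () renaming (Carrier to C₁; _≈_ to _≈₁_; _∙_ to _∙₁_)
  open RawMagma H using () renaming (_≈_ to _≈ₕ_)
  open RawMagma G₂ using () renaming (Carrier to C₂; _≈_ to _≈₂_; _∙_ to _∙₂_)

  χ : GElem r p n → ℕ
  χ g = Δ (proj₁ g) / p % δ

  δp∣Δ-twist : (g : GElem r p n) → δ * p ∣ Δ (scale (A * χ g) (proj₁ g))
  δp∣Δ-twist (g , p∣Δg) =
    subst (δ * p ∣_) (sym Δ-twist) (∣m∣n⇒∣m+n (n∣m*n (s / δ)) (∣n⇒∣m*n (s % δ) δp∣An+p))
    where
    s = Δ g / p
    rearrange : ∀ c t → (c + t * δ) * p + n * (A * c) ≡ t * (δ * p) + c * (A * n + p)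
    rearrange c t = solve (c ∷ t ∷ δ ∷ p ∷ n ∷ A ∷ [])
    Δ-twist : Δ (scale (A * (s % δ)) g) ≡ s / δ * (δ * p) + s % δ * (A * n + p)
    Δ-twist = begin
      Δ (scale (A * (s % δ)) g)                      ≡⟨ Δ-scale (A * (s % δ)) g ⟩
      Δ g + n * (A * (s % δ))                        ≡⟨ cong (_+ n * (A * (s % δ))) (sym (m/n*n≡m p∣Δg)) ⟩
      s * p + n * (A * (s % δ))                      ≡⟨ cong (λ t → t * p + n * (A * (s % δ))) (m≡m%n+[m/n]*n s δ) ⟩
      (s % δ + s / δ * δ) * p + n * (A * (s % δ))    ≡⟨ rearrange (s % δ) (s / δ) ⟩
      s / δ * (δ * p) + s % δ * (A * n + p)          ∎

  twist : GElem r p n → GElem r (δ * p) n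
  twist g = scale (A * χ g) (proj₁ g) , δp∣Δ-twist g

  φ : C₁ → C₂
  φ g = twist g , χ g

  χ-cong : ∀ {g h} → g ≈₁ h → χ g ≡ χ h
  χ-cong {g , p∣Δg} {h , p∣Δh} (_ , k , x≡y) = ≡[mod*]⇒/≡[mod] p∣Δg p∣Δh (begin
    Δ g % (δ * p)                          ≡⟨ ≡[mod]-∣ δp∣r (≡[mod]-sumF (vec g) _ x≡y) ⟩
    sumF (λ i → vec h i + k * Q) % (δ * p) ≡⟨ cong (_% (δ * p)) (sumF-+const (vec h) (k * Q)) ⟩
    (Δ h + n * (k * Q)) % (δ * p)          ≡⟨ %-remove-+ʳ (Δ h) (∣-trans δp∣nQ (*-monoʳ-∣ n (n∣m*n k))) ⟩
    Δ h % (δ * p)                          ∎)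

  χ-homo : ∀ g h → χ (g ∙₁ h) ≡ (χ g + χ h) % δ
  χ-homo (g , p∣Δg) (h , p∣Δh) = begin
    Δ (g · h) / p % δ        ≡⟨ cong (λ t → t / p % δ) (Δ-· g h) ⟩
    (Δ g + Δ h) / p % δ      ≡⟨ cong (_% δ) (+-distrib-/-∣ˡ (Δ h) p∣Δg) ⟩
    (Δ g / p + Δ h / p) % δ  ≡⟨ %-distribˡ-+ (Δ g / p) (Δ h / p) δ ⟩
    (χ (g , p∣Δg) + χ (h , p∣Δh)) % δ  ∎

  φ-cong : ∀ {g h} → g ≈₁ h → φ g ≈₂ φ h
  φ-cong {g} {h} g≈h@(π≡σ , k , x≡y) = (π≡σ , k , x+Aχ≡y+Aχ) , cong (_% δ) (χ-cong {g} {h} g≈h)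
    where
    x+Aχ≡y+Aχ : ∀ i → vec (proj₁ g) i + A * χ g ≡ vec (proj₁ h) i + A * χ h + k * Q [mod r ]
    x+Aχ≡y+Aχ i = begin
      (vec (proj₁ g) i + A * χ g) % r          ≡⟨ ≡[mod]-cong-+ʳ (A * χ g) (x≡y i) ⟩
      (vec (proj₁ h) i + k * Q + A * χ g) % r  ≡⟨ cong (λ c → (vec (proj₁ h) i + k * Q + A * c) % r) (χ-cong {g} {h} g≈h) ⟩
      (vec (proj₁ h) i + k * Q + A * χ h) % r  ≡⟨ cong (_% r) (+-right-comm (vec (proj₁ h) i) _ _) ⟩
      (vec (proj₁ h) i + A * χ h + k * Q) % r  ∎

  φ-homo : ∀ g h → φ (g ∙₁ h) ≈₂ φ g ∙₂ φ h
  φ-homo g@(mon π x , _) h@(mon σ y , _) =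
    ≈-sym {δ * p} {n} {proj₁ (φ g ∙₂ φ h)} {proj₁ (φ (g ∙₁ h))} ((λ _ → refl) , ε * u , λ i → cong (_% r) (twists i)) ,
    trans (cong (_% δ) (χ-homo g h)) (m%n%n≡m%n _ δ)
    where
    ε = (χ g + χ h) / δ
    u = _∣_.quotient Q∣Aδ
    χ+χ≡χ+εδ : χ g + χ h ≡ χ (g ∙₁ h) + ε * δ
    χ+χ≡χ+εδ = trans (m≡m%n+[m/n]*n (χ g + χ h) δ) (cong (_+ ε * δ) (sym (χ-homo g h)))
    A[c+εδ] : ∀ c → A * (c + ε * δ) ≡ A * c + ε * u * Q
    A[c+εδ] c = begin
      A * (c + ε * δ)      ≡⟨ distribute A c ε δ ⟩
      A * c + ε * (A * δ)  ≡⟨ cong (λ t → A * c + ε * t) (_∣_.equality Q∣Aδ) ⟩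
      A * c + ε * (u * Q)  ≡⟨ cong (A * c +_) (sym (*-assoc ε u Q)) ⟩
      A * c + ε * u * Q    ∎
      where
      distribute : ∀ A c ε δ → A * (c + ε * δ) ≡ A * c + ε * (A * δ)
      distribute A c ε δ = solve (A ∷ c ∷ ε ∷ δ ∷ [])
    twists : ∀ i → x (σ ⟨$⟩ʳ i) + A * χ g + (y i + A * χ h)
                 ≡ x (σ ⟨$⟩ʳ i) + y i + A * χ (g ∙₁ h) + ε * u * Q
    twists i = let a = x (σ ⟨$⟩ʳ i); b = y i in begin
      a + A * χ g + (b + A * χ h)               ≡⟨ +-interchange a _ b _ ⟩
      a + b + (A * χ g + A * χ h)               ≡⟨ cong (a + b +_) (sym (*-distribˡ-+ A (χ g) (χ h))) ⟩
      a + b + A * (χ g + χ h)                   ≡⟨ cong (λ c → a + b + A * c) χ+χ≡χ+εδ ⟩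
      a + b + A * (χ (g ∙₁ h) + ε * δ)          ≡⟨ cong (a + b +_) (A[c+εδ] (χ (g ∙₁ h))) ⟩
      a + b + (A * χ (g ∙₁ h) + ε * u * Q)      ≡⟨ sym (+-assoc (a + b) _ _) ⟩
      a + b + A * χ (g ∙₁ h) + ε * u * Q        ∎

  φ-injective : ∀ {g h} → φ g ≈₂ φ h → g ≈₁ h
  φ-injective {g} {h} ((π≡σ , k , x≡y) , χg≡χh[δ]) = π≡σ , k , λ i →
    ≡[mod]-cancel-+ʳ (A * χ g) (begin
      (vec (proj₁ g) i + A * χ g) % r          ≡⟨ x≡y i ⟩
      (vec (proj₁ h) i + A * χ h + k * Q) % r  ≡⟨ cong (_% r) (+-right-comm (vec (proj₁ h) i) _ _) ⟩
      (vec (proj₁ h) i + k * Q + A * χ h) % r  ≡⟨ cong (λ c → (vec (proj₁ h) i + k * Q + A * c) % r) (sym χg≡χh) ⟩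
      (vec (proj₁ h) i + k * Q + A * χ g) % r  ∎)
    where
    χg≡χh : χ g ≡ χ h
    χg≡χh = trans (sym (m%n%n≡m%n _ δ)) (trans χg≡χh[δ] (m%n%n≡m%n _ δ))

  ≈₂-trans : ∀ {u v w} → u ≈₂ v → v ≈₂ w → u ≈₂ w
  ≈₂-trans {u} {v} {w} (u≈v , c≡d) (v≈w , d≡e) =
    ≈-trans {g = proj₁ u} {proj₁ v} {proj₁ w} u≈v v≈w , trans c≡d d≡e

  -- The preimage of (w, c) is w · c^{−A c}, with −A c represented by (r − 1) A c.
  untwist : GElem r (δ * p) n → ℕ → GElem r p n
  untwist (w , δp∣Δw) c = scale (pred r * A * (c % δ)) w , p∣Δ
    where
    regroup : ∀ k c → k * c * (A * n) ≡ n * (k * A * c)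
    regroup k c = solve (k ∷ c ∷ A ∷ n ∷ [])
    p∣An : p ∣ A * n
    p∣An = ∣m+n∣m⇒∣n (subst (p ∣_) (+-comm (A * n) p) (∣-trans (n∣m*n δ) δp∣An+p)) ∣-refl
    p∣Δ : p ∣ Δ (scale (pred r * A * (c % δ)) w)
    p∣Δ = subst (p ∣_) (sym (Δ-scale (pred r * A * (c % δ)) w))
      (∣m∣n⇒∣m+n (∣-trans (n∣m*n δ) δp∣Δw)
                 (subst (p ∣_) (regroup (pred r) (c % δ)) (∣n⇒∣m*n (pred r * (c % δ)) p∣An)))

  χ-untwist : ∀ w c → χ (untwist w c) ≡ c % δ
  χ-untwist w@(g , δp∣Δg) c = begin
    T % δ                 ≡⟨ sym (%-remove-+ʳ T (∣m⇒∣m*n c′ (∣-trans (m∣m*n p) δp∣r))) ⟩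
    (T + r * c′) % δ      ≡⟨ cong (λ t → (T + t * c′) % δ) (sym (suc-pred r)) ⟩
    (T + (c′ + k * c′)) % δ ≡⟨ cong (_% δ) (+-shuffle T c′ (k * c′)) ⟩
    (T + k * c′ + c′) % δ ≡⟨ %-remove-+ˡ c′ δ∣T+kc′ ⟩
    c′ % δ                ≡⟨ m%n%n≡m%n c δ ⟩
    c′                    ∎
    where
    c′ = c % δ
    k = pred r
    T = Δ (proj₁ (untwist w c)) / p
    regroup : ∀ k c → n * (k * A * c) + k * c * p ≡ k * c * (A * n + p)
    regroup k c = solve (k ∷ c ∷ n ∷ A ∷ p ∷ [])
    [T+kc′]p : (T + k * c′) * p ≡ Δ g + k * c′ * (A * n + p)
    [T+kc′]p = begin
      (T + k * c′) * p                         ≡⟨ *-distribʳ-+ p T (k * c′) ⟩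
      T * p + k * c′ * p                       ≡⟨ cong (_+ k * c′ * p) (m/n*n≡m (proj₂ (untwist w c))) ⟩
      Δ (proj₁ (untwist w c)) + k * c′ * p     ≡⟨ cong (_+ k * c′ * p) (Δ-scale (k * A * c′) g) ⟩
      Δ g + n * (k * A * c′) + k * c′ * p      ≡⟨ +-assoc (Δ g) _ _ ⟩
      Δ g + (n * (k * A * c′) + k * c′ * p)    ≡⟨ cong (Δ g +_) (regroup k c′) ⟩
      Δ g + k * c′ * (A * n + p)               ∎
    δ∣T+kc′ : δ ∣ T + k * c′
    δ∣T+kc′ = *-cancelʳ-∣ p (subst (δ * p ∣_) (sym [T+kc′]p)
                (∣m∣n⇒∣m+n δp∣Δg (∣n⇒∣m*n (k * c′) δp∣An+p)))

  twist-untwist : ∀ w c → twist (untwist w c) ≈ₕ w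
  twist-untwist w@(mon π x , _) c = (λ _ → refl) , 0 , λ i → begin
    (x i + k * A * c′ + A * χ (untwist w c)) % r  ≡⟨ cong (λ t → (x i + k * A * c′ + A * t) % r) (χ-untwist w c) ⟩
    (x i + k * A * c′ + A * c′) % r               ≡⟨ cong (_% r) (collect (x i) k A c′) ⟩
    (x i + A * c′ * suc k) % r                    ≡⟨ cong (λ t → (x i + A * c′ * t) % r) (suc-pred r) ⟩
    (x i + A * c′ * r) % r                        ≡⟨ [m+kn]%n≡m%n (x i) (A * c′) r ⟩
    x i % r                                       ≡⟨ cong (_% r) (sym (+-identityʳ (x i))) ⟩
    (x i + 0) % r                                 ∎
    where
    c′ = c % δ
    k = pred r
    collect : ∀ a k A c → a + k * A * c + A * c ≡ a + A * c * suc k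
    collect a k A c = solve (a ∷ k ∷ A ∷ c ∷ [])

  φ-surjective : ∀ y → ∃ λ x → ∀ {z} → z ≈₁ x → φ z ≈₂ y
  φ-surjective y@(w , c) = untwist w c , λ {z} z≈x →
    ≈₂-trans {φ z} {φ (untwist w c)} {y} (φ-cong {z} {untwist w c} z≈x)
      (twist-untwist w c , trans (cong (_% δ) (χ-untwist w c)) (m%n%n≡m%n c δ))

  splitting : G₁ ≅ G₂
  splitting = φ , record
    { isMagmaMonomorphism = record
      { isMagmaHomomorphism = record
        { isRelHomomorphism = record { cong = λ {g} {h} → φ-cong {g} {h} }
        ; homo = φ-homo }
      ; injective = λ {g} {h} → φ-injective {g} {h} }
    ; surjective = φ-surjective }

-- Multiplicities of primes

infix 4 _^_∥_
record _^_∥_ (ℓ k m : ℕ) : Set where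
  constructor exactly
  field
    pow∣ : ℓ ^ k ∣ m
    pow∤ : ¬ ℓ ^ suc k ∣ m
open _^_∥_

^-monoʳ-∣ : ∀ ℓ {i j} → i ≤ j → ℓ ^ i ∣ ℓ ^ j
^-monoʳ-∣ ℓ {i} {j} i≤j = divides (ℓ ^ (j ∸ i)) (begin
  ℓ ^ j                ≡⟨ cong (ℓ ^_) (sym (m+[n∸m]≡n i≤j)) ⟩
  ℓ ^ (i + (j ∸ i))    ≡⟨ ^-distribˡ-+-* ℓ i (j ∸ i) ⟩
  ℓ ^ i * ℓ ^ (j ∸ i)  ≡⟨ *-comm (ℓ ^ i) _ ⟩
  ℓ ^ (j ∸ i) * ℓ ^ i  ∎)
  where open ≡-Reasoning

module _ {ℓ : ℕ} where

  ∥-maximal : ∀ {a k m} → ℓ ^ a ∥ m → ℓ ^ k ∣ m → k ≤ a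
  ∥-maximal {a} {k} ℓ^a∥m ℓ^k∣m with k ≤? a
  ... | yes k≤a = k≤a
  ... | no  k≰a = contradiction (∣-trans (^-monoʳ-∣ ℓ (≰⇒> k≰a)) ℓ^k∣m) (pow∤ ℓ^a∥m)

  ∥-unique : ∀ {a b m} → ℓ ^ a ∥ m → ℓ ^ b ∥ m → a ≡ b
  ∥-unique ℓ^a∥m ℓ^b∥m = ≤-antisym (∥-maximal ℓ^b∥m (pow∣ ℓ^a∥m)) (∥-maximal ℓ^a∥m (pow∣ ℓ^b∥m))

  ∥-gcd : ∀ {a b x y} → ℓ ^ a ∥ x → ℓ ^ b ∥ y → ℓ ^ (a ⊓ b) ∥ gcd x y
  ∥-gcd {a} {b} {x} {y} ℓ^a∥x ℓ^b∥y = exactly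
    (gcd-greatest (∣-trans (^-monoʳ-∣ ℓ (m⊓n≤m a b)) (pow∣ ℓ^a∥x))
                  (∣-trans (^-monoʳ-∣ ℓ (m⊓n≤n a b)) (pow∣ ℓ^b∥y)))
    not-higher
    where
    not-higher : ¬ ℓ ^ suc (a ⊓ b) ∣ gcd x y
    not-higher ∣gcd with ≤-total a b
    ... | inj₁ a≤b = pow∤ ℓ^a∥x (subst (λ t → ℓ ^ suc t ∣ x) (m≤n⇒m⊓n≡m a≤b) (∣-trans ∣gcd (gcd[m,n]∣m x y)))
    ... | inj₂ b≤a = pow∤ ℓ^b∥y (subst (λ t → ℓ ^ suc t ∣ y) (m≥n⇒m⊓n≡n b≤a) (∣-trans ∣gcd (gcd[m,n]∣n x y)))

  ∥⇒∤quotient : ∀ {a x} (ℓ^a∥x : ℓ ^ a ∥ x) → ¬ ℓ ∣ quotient (pow∣ ℓ^a∥x)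
  ∥⇒∤quotient {a} ℓ^a∥x ℓ∣x′ =
    pow∤ ℓ^a∥x (subst (ℓ * ℓ ^ a ∣_) (sym (_∣_.equality (pow∣ ℓ^a∥x))) (*-monoˡ-∣ (ℓ ^ a) ℓ∣x′))

module _ {ℓ : ℕ} (pℓ : Prime ℓ) where
  private instance
    ℓ≢0 : NonZero ℓ
    ℓ≢0 = prime⇒nonZero pℓ

  ∥-* : ∀ {a b x y} → ℓ ^ a ∥ x → ℓ ^ b ∥ y → ℓ ^ (a + b) ∥ x * y
  ∥-* {a} {b} {x} {y} ℓ^a∥x ℓ^b∥y = exactly
    (subst (_∣ x * y) (sym (^-distribˡ-+-* ℓ a b)) (*-pres-∣ (pow∣ ℓ^a∥x) (pow∣ ℓ^b∥y)))
    not-higher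
    where
    instance
      ℓ^[a+b]≢0 : NonZero (ℓ ^ (a + b))
      ℓ^[a+b]≢0 = m^n≢0 ℓ (a + b)
    x′ = quotient (pow∣ ℓ^a∥x)
    y′ = quotient (pow∣ ℓ^b∥y)
    xy≡x′y′ℓ^[a+b] : x * y ≡ x′ * y′ * ℓ ^ (a + b)
    xy≡x′y′ℓ^[a+b] = begin
      x * y                          ≡⟨ cong₂ _*_ (_∣_.equality (pow∣ ℓ^a∥x)) (_∣_.equality (pow∣ ℓ^b∥y)) ⟩
      x′ * ℓ ^ a * (y′ * ℓ ^ b)      ≡⟨ *-interchange x′ (ℓ ^ a) y′ (ℓ ^ b) ⟩
      x′ * y′ * (ℓ ^ a * ℓ ^ b)      ≡⟨ cong (x′ * y′ *_) (sym (^-distribˡ-+-* ℓ a b)) ⟩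
      x′ * y′ * ℓ ^ (a + b)          ∎
      where open ≡-Reasoning
    not-higher : ¬ ℓ ^ suc (a + b) ∣ x * y
    not-higher ∣xy with euclidsLemma x′ y′ pℓ
      (*-cancelʳ-∣ (ℓ ^ (a + b)) (subst (ℓ * ℓ ^ (a + b) ∣_) xy≡x′y′ℓ^[a+b] ∣xy))
    ... | inj₁ ℓ∣x′ = ∥⇒∤quotient ℓ^a∥x ℓ∣x′
    ... | inj₂ ℓ∣y′ = ∥⇒∤quotient ℓ^b∥y ℓ∣y′

  multiplicity : ∀ m .{{_ : NonZero m}} → ∃ λ k → ℓ ^ k ∥ m
  multiplicity m = go m (<-wellFounded m)
    where
    go : ∀ m .{{_ : NonZero m}} → Acc _<_ m → ∃ λ k → ℓ ^ k ∥ m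
    go m _ with ℓ ∣? m
    go m _ | no ℓ∤m = 0 , exactly (1∣ m) (ℓ∤m ∘ subst (_∣ m) (*-identityʳ ℓ))
    go .(j * ℓ) (acc rec) | yes (divides-refl j) =
      let instance j≢0 = m*n≢0⇒m≢0 j {ℓ}
          k , ℓ^k∥j = go j (rec (m<m*n j ℓ (nonTrivial⇒n>1 ℓ {{prime⇒nonTrivial pℓ}})))
      in suc k , exactly
        (subst (ℓ * ℓ ^ k ∣_) (*-comm ℓ j) (*-monoʳ-∣ ℓ (pow∣ ℓ^k∥j)))
        (λ ∣jℓ → pow∤ ℓ^k∥j (*-cancelˡ-∣ ℓ (subst (ℓ * ℓ ^ suc k ∣_) (*-comm j ℓ) ∣jℓ)))

gcd≢0ˡ : ∀ m n .{{_ : NonZero m}} → NonZero (gcd m n)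
gcd≢0ˡ m n = ≢-nonZero (gcd[m,n]≢0 m n (inj₁ (≢-nonZero⁻¹ m)))

module Valuation {ℓ : ℕ} (pℓ : Prime ℓ) where

  v : ∀ m .{{_ : NonZero m}} → ℕ
  v m = proj₁ (multiplicity pℓ m)

  v-∥ : ∀ m .{{_ : NonZero m}} → ℓ ^ v m ∥ m
  v-∥ m = proj₂ (multiplicity pℓ m)

  v-cong : ∀ {x y} .{{_ : NonZero x}} .{{_ : NonZero y}} → x ≡ y → v x ≡ v y
  v-cong refl = refl

  v-maximal : ∀ {k} m .{{_ : NonZero m}} → ℓ ^ k ∣ m → k ≤ v m
  v-maximal m = ∥-maximal (v-∥ m)

  v-∣ : ∀ {x y} .{{_ : NonZero x}} .{{_ : NonZero y}} → x ∣ y → v x ≤ v y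
  v-∣ {x} {y} x∣y = v-maximal y (∣-trans (pow∣ (v-∥ x)) x∣y)

  v>0⇒∣ : ∀ m .{{_ : NonZero m}} → 0 < v m → ℓ ∣ m
  v>0⇒∣ m 0<vm = subst (_∣ m) (*-identityʳ ℓ) (∣-trans (^-monoʳ-∣ ℓ 0<vm) (pow∣ (v-∥ m)))

  v-* : ∀ x y .{{_ : NonZero x}} .{{_ : NonZero y}} → v (x * y) {{m*n≢0 x y}} ≡ v x + v y
  v-* x y = ∥-unique (v-∥ (x * y) {{m*n≢0 x y}}) (∥-* pℓ (v-∥ x) (v-∥ y))

  v-gcd : ∀ x y .{{_ : NonZero x}} .{{_ : NonZero y}} → v (gcd x y) {{gcd≢0ˡ x y}} ≡ v x ⊓ v y
  v-gcd x y = ∥-unique (v-∥ (gcd x y) {{gcd≢0ˡ x y}}) (∥-gcd (v-∥ x) (v-∥ y))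

  v-*-≡ : ∀ {x y z} .{{_ : NonZero x}} .{{_ : NonZero y}} .{{_ : NonZero z}} →
          x * y ≡ z → v x + v y ≡ v z
  v-*-≡ {x} {y} xy≡z = trans (sym (v-* x y)) (v-cong {{m*n≢0 x y}} xy≡z)

  v-gcd-cong : ∀ {x y m} .{{_ : NonZero x}} .{{_ : NonZero y}} .{{_ : NonZero m}} →
               gcd x m ≡ gcd y m → v x ⊓ v m ≡ v y ⊓ v m
  v-gcd-cong {x} {y} {m} gcd≡gcd =
    trans (sym (v-gcd x m)) (trans (v-cong {{gcd≢0ˡ x m}} {{gcd≢0ˡ y m}} gcd≡gcd) (v-gcd y m))

  Special⇒v≢ : ∀ {x y} .{{_ : NonZero x}} .{{_ : NonZero y}} → Special x y ℓ → v x ≢ v y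
  Special⇒v≢ {x} {y} (_ , k , k′ , ℓ^k∥x , ℓ^k′∥y , k≢k′) vx≡vy = k≢k′ (begin
    k    ≡⟨ ∥-unique (exactly (proj₁ ℓ^k∥x) (proj₂ ℓ^k∥x)) (v-∥ x) ⟩
    v x  ≡⟨ vx≡vy ⟩
    v y  ≡⟨ ∥-unique (v-∥ y) (exactly (proj₁ ℓ^k′∥y) (proj₂ ℓ^k′∥y)) ⟩
    k′   ∎)
    where open ≡-Reasoning

  v≢⇒Special : ∀ {x y} .{{_ : NonZero x}} .{{_ : NonZero y}} → v x ≢ v y → Special x y ℓ
  v≢⇒Special {x} {y} vx≢vy =
    pℓ , v x , v y , (pow∣ (v-∥ x) , pow∤ (v-∥ x)) , (pow∣ (v-∥ y) , pow∤ (v-∥ y)) , vx≢vy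

-- Induction along a prime factorisation of d, dividing out one prime at a time.
v-≤⇒∣ : ∀ d m .{{_ : NonZero d}} .{{_ : NonZero m}} →
        (∀ {ℓ} (pℓ : Prime ℓ) → Valuation.v pℓ d ≤ Valuation.v pℓ m) → d ∣ m
v-≤⇒∣ d m v≤v = subst (_∣ m) (sym isFactorisation)
  (product∣ factorsPrime m (λ pℓ → subst (_≤ _) (Valuation.v-cong pℓ isFactorisation) (v≤v pℓ)))
  where
  open PrimeFactorisation (factorise d)
  instance
    ∏factors≢0 : NonZero (product factors)
    ∏factors≢0 = productOfPrimes≢0 factorsPrime
  product∣ : ∀ {as} (ps : All Prime as) m .{{_ : NonZero m}} →
             (∀ {ℓ} (pℓ : Prime ℓ) → Valuation.v pℓ (product as) {{productOfPrimes≢0 ps}} ≤ Valuation.v pℓ m) →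
             product as ∣ m
  product∣ All.[] m _ = 1∣ m
  product∣ {ℓ₀ ∷ as} (pℓ₀ All.∷ ps) m v≤v = subst (ℓ₀ * P ∣_) (sym m≡ℓ₀m′) (*-monoʳ-∣ ℓ₀ P∣m′)
    where
    P = product as
    instance
      ℓ₀≢0 : NonZero ℓ₀
      ℓ₀≢0 = prime⇒nonZero pℓ₀
      P≢0 : NonZero P
      P≢0 = productOfPrimes≢0 ps
      ℓ₀P≢0 : NonZero (ℓ₀ * P)
      ℓ₀P≢0 = m*n≢0 ℓ₀ P
    ℓ₀∣m : ℓ₀ ∣ m
    ℓ₀∣m = Valuation.v>0⇒∣ pℓ₀ m (≤-trans (Valuation.v-maximal pℓ₀ (ℓ₀ * P) ℓ₀^1∣ℓ₀P) (v≤v pℓ₀))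
      where
      ℓ₀^1∣ℓ₀P : ℓ₀ ^ 1 ∣ ℓ₀ * P
      ℓ₀^1∣ℓ₀P = subst (_∣ ℓ₀ * P) (sym (*-identityʳ ℓ₀)) (m∣m*n P)
    m′ = quotient ℓ₀∣m
    m≡ℓ₀m′ : m ≡ ℓ₀ * m′
    m≡ℓ₀m′ = m∣n⇒n≡m*quotient ℓ₀∣m
    instance
      m′≢0 : NonZero m′
      m′≢0 = quotient≢0 ℓ₀∣m
      ℓ₀m′≢0 : NonZero (ℓ₀ * m′)
      ℓ₀m′≢0 = m*n≢0 ℓ₀ m′
    P∣m′ : P ∣ m′
    P∣m′ = product∣ ps m′ λ pℓ → let open Valuation pℓ in +-cancelˡ-≤ (v ℓ₀) _ _ (begin
      v ℓ₀ + v P      ≡⟨ sym (v-* ℓ₀ P) ⟩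
      v (ℓ₀ * P)      ≤⟨ v≤v pℓ ⟩
      v m             ≡⟨ v-cong m≡ℓ₀m′ ⟩
      v (ℓ₀ * m′)     ≡⟨ v-* ℓ₀ m′ ⟩
      v ℓ₀ + v m′     ∎)
      where open ≤-Reasoning

m⊓o≡n⊓o∧m≢n⇒o≤m : ∀ {m n o} → m ⊓ o ≡ n ⊓ o → m ≢ n → o ≤ m
m⊓o≡n⊓o∧m≢n⇒o≤m {m} {n} {o} m⊓o≡n⊓o m≢n with ≤-total o m
... | inj₁ o≤m = o≤m
... | inj₂ m≤o with ≤-total n o
...   | inj₁ n≤o = contradiction (trans (sym (m≤n⇒m⊓n≡m m≤o)) (trans m⊓o≡n⊓o (m≤n⇒m⊓n≡m n≤o))) m≢n
...   | inj₂ o≤n = ≤-reflexive (trans (sym (m≥n⇒m⊓n≡n o≤n)) (trans (sym m⊓o≡n⊓o) (m≤n⇒m⊓n≡m m≤o)))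

gcd∣⇒∃[n∣m*t+c] : ∀ m n c .{{_ : NonZero n}} → gcd m n ∣ c → ∃ λ t → n ∣ m * t + c
gcd∣⇒∃[n∣m*t+c] m n@(suc k) .(s * gcd m n) (divides-refl s) with Bézout.identity (gcd-GCD m n)
... | Bézout.-+ x y d+xm≡yn = x * s , divides (y * s) (begin
  m * (x * s) + s * gcd m n   ≡⟨ regroup m x s (gcd m n) ⟩
  (gcd m n + x * m) * s       ≡⟨ cong (_* s) d+xm≡yn ⟩
  y * n * s                   ≡⟨ *-right-comm y n s ⟩
  y * s * n                   ∎)
  where
  open ≡-Reasoning
  regroup : ∀ m x s d → m * (x * s) + s * d ≡ (d + x * m) * s
  regroup m x s d = solve (m ∷ x ∷ s ∷ d ∷ [])
-- Here x m ≡ d (mod n), so −d s ≡ x s (n − 1) m.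
... | Bézout.+- x y d+yn≡xm = x * s * k , divides (s * gcd m n + y * s * k) (begin
  m * (x * s * k) + s * gcd m n          ≡⟨ regroup m x s k (gcd m n) ⟩
  x * m * s * k + s * gcd m n            ≡⟨ cong (λ t → t * s * k + s * gcd m n) (sym d+yn≡xm) ⟩
  (gcd m n + y * suc k) * s * k + s * gcd m n ≡⟨ factor (gcd m n) y s k ⟩
  (s * gcd m n + y * s * k) * suc k      ∎)
  where
  open ≡-Reasoning
  regroup : ∀ m x s k d → m * (x * s * k) + s * d ≡ x * m * s * k + s * d
  regroup m x s k d = solve (m ∷ x ∷ s ∷ k ∷ d ∷ [])
  factor : ∀ d y s k → (d + y * suc k) * s * k + s * d ≡ (s * d + y * s * k) * suc k
  factor d y s k = solve (d ∷ y ∷ s ∷ k ∷ [])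

-- The special part δ

module SpecialFactor
  (r n p p′ q q′ η δ : ℕ)
  .{{_ : NonZero r}} .{{_ : NonZero n}} .{{_ : NonZero p}} .{{_ : NonZero p′}}
  .{{_ : NonZero q}} .{{_ : NonZero q′}} .{{_ : NonZero η}} .{{_ : NonZero δ}}
  (p∣r : p ∣ r) (q∣r : q ∣ r) (pq≡p′q′ : p * q ≡ p′ * q′)
  (gcd[p,n]≡gcd[p′,n] : gcd p n ≡ gcd p′ n) (gcd[q,n]≡gcd[q′,n] : gcd q n ≡ gcd q′ n)
  (ηδpq≡rn : η * δ * (p * q) ≡ r * n)
  (η-nonspecial : ∀ ℓ → Prime ℓ → ℓ ∣ η → ¬ Special p p′ ℓ)
  (δ-special : ∀ ℓ → Prime ℓ → ℓ ∣ δ → Special p p′ ℓ)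
  where

  Q : ℕ
  Q = r / q

  instance
    Q≢0 : NonZero Q
    Q≢0 = >-nonZero (m≥n⇒m/n>0 (∣⇒≤ q∣r))
    gcd[Q,δ]≢0 : NonZero (gcd Q δ)
    gcd[Q,δ]≢0 = gcd≢0ˡ Q δ

  L : ℕ
  L = Q / gcd Q δ

  instance
    L≢0 : NonZero L
    L≢0 = ≢-nonZero (m/gcd[m,n]≢0 Q δ)
    δp≢0 : NonZero (δ * p)
    δp≢0 = m*n≢0 δ p
    pq≢0 : NonZero (p * q)
    pq≢0 = m*n≢0 p q
    p′q′≢0 : NonZero (p′ * q′)
    p′q′≢0 = m*n≢0 p′ q′
    ηδ≢0 : NonZero (η * δ)
    ηδ≢0 = m*n≢0 η δ
    rn≢0 : NonZero (r * n)
    rn≢0 = m*n≢0 r n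
    Ln≢0 : NonZero (L * n)
    Ln≢0 = m*n≢0 L n
    gcd[Ln,δp]≢0 : NonZero (gcd (L * n) (δ * p))
    gcd[Ln,δp]≢0 = gcd≢0ˡ (L * n) (δ * p)

  Qq≡r : Q * q ≡ r
  Qq≡r = m/n*n≡m q∣r

  module AtPrime {ℓ} (pℓ : Prime ℓ) where
    open Valuation pℓ

    vQ+vq≡vr : v Q + v q ≡ v r
    vQ+vq≡vr = v-*-≡ Qq≡r

    vL+vQ⊓vδ≡vQ : v L + v Q ⊓ v δ ≡ v Q
    vL+vQ⊓vδ≡vQ = trans (cong (v L +_) (sym (v-gcd Q δ))) (v-*-≡ (m/n*n≡m (gcd[m,n]∣m Q δ)))

    vp+vq≡vp′+vq′ : v p + v q ≡ v p′ + v q′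
    vp+vq≡vp′+vq′ = trans (v-*-≡ pq≡p′q′) (v-* p′ q′)

    v[ηδ]+[vp+vq]≡vr+vn : v η + v δ + (v p + v q) ≡ v r + v n
    v[ηδ]+[vp+vq]≡vr+vn = begin
      v η + v δ + (v p + v q)     ≡⟨ cong₂ _+_ (sym (v-* η δ)) (sym (v-* p q)) ⟩
      v (η * δ) + v (p * q)       ≡⟨ v-*-≡ ηδpq≡rn ⟩
      v (r * n)                   ≡⟨ v-* r n ⟩
      v r + v n                   ∎
      where open ≡-Reasoning

    -- Distinct multiplicities of p and p′ are compatible with the gcd conditions
    -- only if n has smaller multiplicity than p and q.
    module AtSpecialPrime (0<vδ : 0 < v δ) where

      vp≢vp′ : v p ≢ v p′
      vp≢vp′ = Special⇒v≢ (δ-special ℓ pℓ (v>0⇒∣ δ 0<vδ))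

      vη≡0 : v η ≡ 0
      vη≡0 with v η ≟ 0
      ... | yes vη≡0 = vη≡0
      ... | no  vη≢0 = contradiction (v≢⇒Special vp≢vp′) (η-nonspecial ℓ pℓ (v>0⇒∣ η (n≢0⇒n>0 vη≢0)))

      vn≤vp : v n ≤ v p
      vn≤vp = m⊓o≡n⊓o∧m≢n⇒o≤m (v-gcd-cong gcd[p,n]≡gcd[p′,n]) vp≢vp′

      vn≤vq : v n ≤ v q
      vn≤vq = m⊓o≡n⊓o∧m≢n⇒o≤m (v-gcd-cong gcd[q,n]≡gcd[q′,n])
        (λ vq≡vq′ → vp≢vp′ (+-cancelʳ-≡ (v q) _ _ (trans vp+vq≡vp′+vq′ (cong (v p′ +_) (sym vq≡vq′)))))

      vδ+[vp+vq]≡vr+vn : v δ + (v p + v q) ≡ v r + v n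
      vδ+[vp+vq]≡vr+vn = subst (λ e → e + v δ + (v p + v q) ≡ v r + v n) vη≡0 v[ηδ]+[vp+vq]≡vr+vn

      vQ+vn≡vδ+vp : v Q + v n ≡ v δ + v p
      vQ+vn≡vδ+vp = +-cancelʳ-≡ (v q) _ _ (begin
        v Q + v n + v q      ≡⟨ +-right-comm (v Q) (v n) (v q) ⟩
        v Q + v q + v n      ≡⟨ cong (_+ v n) vQ+vq≡vr ⟩
        v r + v n            ≡⟨ sym vδ+[vp+vq]≡vr+vn ⟩
        v δ + (v p + v q)    ≡⟨ sym (+-assoc (v δ) (v p) (v q)) ⟩
        v δ + v p + v q      ∎)
        where open ≡-Reasoning

      vL+vn≡vp : v L + v n ≡ v p
      vL+vn≡vp = +-cancelʳ-≡ (v δ) _ _ (begin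
        v L + v n + v δ      ≡⟨ +-right-comm (v L) (v n) (v δ) ⟩
        v L + v δ + v n      ≡⟨ cong (λ m → v L + m + v n) (sym (m≥n⇒m⊓n≡n vδ≤vQ)) ⟩
        v L + v Q ⊓ v δ + v n ≡⟨ cong (_+ v n) vL+vQ⊓vδ≡vQ ⟩
        v Q + v n            ≡⟨ vQ+vn≡vδ+vp ⟩
        v δ + v p            ≡⟨ +-comm (v δ) (v p) ⟩
        v p + v δ            ∎)
        where
        open ≡-Reasoning
        vδ≤vQ : v δ ≤ v Q
        vδ≤vQ = +-cancelʳ-≤ (v n) _ _
          (≤-trans (+-monoʳ-≤ (v δ) vn≤vp) (≤-reflexive (sym vQ+vn≡vδ+vp)))

    vδ+vp≤vr : v δ + v p ≤ v r
    vδ+vp≤vr with v δ ≟ 0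
    ... | yes vδ≡0 = subst (λ e → e + v p ≤ v r) (sym vδ≡0) (v-∣ p∣r)
    ... | no  vδ≢0 = +-cancelʳ-≤ (v n) _ _ (begin
      v δ + v p + v n        ≤⟨ +-monoʳ-≤ (v δ + v p) vn≤vq ⟩
      v δ + v p + v q        ≡⟨ +-assoc (v δ) (v p) (v q) ⟩
      v δ + (v p + v q)      ≡⟨ vδ+[vp+vq]≡vr+vn ⟩
      v r + v n              ∎)
      where
      open AtSpecialPrime (n≢0⇒n>0 vδ≢0)
      open ≤-Reasoning

    v[δp]≤vr : v (δ * p) ≤ v r
    v[δp]≤vr = subst (_≤ v r) (sym (v-* δ p)) vδ+vp≤vr

    v[gcd[Ln,δp]]≤vp : v (gcd (L * n) (δ * p)) ≤ v p
    v[gcd[Ln,δp]]≤vp = subst (_≤ v p) (sym v[gcd[Ln,δp]]) (⊓≤vp (v δ ≟ 0))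
      where
      v[gcd[Ln,δp]] : v (gcd (L * n) (δ * p)) ≡ (v L + v n) ⊓ (v δ + v p)
      v[gcd[Ln,δp]] = trans (v-gcd (L * n) (δ * p)) (cong₂ _⊓_ (v-* L n) (v-* δ p))
      ⊓≤vp : Dec (v δ ≡ 0) → (v L + v n) ⊓ (v δ + v p) ≤ v p
      ⊓≤vp (yes vδ≡0) = ≤-trans (m⊓n≤n _ _) (≤-reflexive (cong (_+ v p) vδ≡0))
      ⊓≤vp (no  vδ≢0) = ≤-trans (m⊓n≤m _ _) (≤-reflexive (AtSpecialPrime.vL+vn≡vp (n≢0⇒n>0 vδ≢0)))

  δp∣r : δ * p ∣ r
  δp∣r = v-≤⇒∣ (δ * p) r AtPrime.v[δp]≤vr

  δpq∣rn : δ * p * q ∣ r * n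
  δpq∣rn = divides η (trans (sym ηδpq≡rn) (regroup η δ p q))
    where
    regroup : ∀ η δ p q → η * δ * (p * q) ≡ η * (δ * p * q)
    regroup η δ p q = solve (η ∷ δ ∷ p ∷ q ∷ [])

  δp∣nQ : δ * p ∣ n * Q
  δp∣nQ = divides η (*-cancelʳ-≡ _ _ q (begin
    n * Q * q          ≡⟨ *-assoc n Q q ⟩
    n * (Q * q)        ≡⟨ cong (n *_) Qq≡r ⟩
    n * r              ≡⟨ *-comm n r ⟩
    r * n              ≡⟨ sym ηδpq≡rn ⟩
    η * δ * (p * q)    ≡⟨ regroup η δ p q ⟩
    η * (δ * p) * q    ∎))
    where
    open ≡-Reasoning
    regroup : ∀ η δ p q → η * δ * (p * q) ≡ η * (δ * p) * q
    regroup η δ p q = solve (η ∷ δ ∷ p ∷ q ∷ [])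

  twisting-exponent : ∃ λ A → δ * p ∣ A * n + p × Q ∣ A * δ
  twisting-exponent = L * t , subst (δ * p ∣_) (cong (_+ p) (*-right-comm L n t)) δp∣Lnt+p , Q∣Ltδ
    where
    solution = gcd∣⇒∃[n∣m*t+c] (L * n) (δ * p) p (v-≤⇒∣ _ p AtPrime.v[gcd[Ln,δp]]≤vp)
    t = proj₁ solution
    δp∣Lnt+p = proj₂ solution
    Q∣Ltδ : Q ∣ L * t * δ
    Q∣Ltδ = subst₂ _∣_ (m/n*n≡m (gcd[m,n]∣m Q δ)) (sym (*-assoc L t δ))
      (*-monoʳ-∣ L (∣n⇒∣m*n t (gcd[m,n]∣n Q δ)))

proposition3p2 :
    ∀ (r n p p' q q' : ℕ) →
      .{{_ : NonZero r}} → .{{_ : NonZero n}} →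
      .{{_ : NonZero p}} → .{{_ : NonZero p'}} →
      .{{_ : NonZero q}} → .{{_ : NonZero q'}} →
      p ∣ r → p' ∣ r → q ∣ r → q' ∣ r →
      p * q ≡ p' * q' → p * q ∣ r * n →
      gcd p n ≡ gcd p' n → gcd q n ≡ gcd q' n →
      ∀ (η δ : ℕ) → .{{_ : NonZero η}} → .{{_ : NonZero δ}} →
      η * δ * (p * q) ≡ r * n →
      (∀ ℓ → Prime ℓ → ℓ ∣ η → ¬ Special p p' ℓ) →
      (∀ ℓ → Prime ℓ → ℓ ∣ δ → Special p p' ℓ) →
      (δ * p ∣ r) × (δ * p * q ∣ r * n)
        × (Gpq r p q n ≅ (Gpq r (δ * p) q n ×ℤ δ))
proposition3p2 r n p p' q q' p∣r _ q∣r _ pq≡p'q' _ gp gq η δ ηδpq≡rn η-nonspecial δ-special =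
  δp∣r , δpq∣rn , Splitting.splitting r n p q δ A q∣r δp∣r δp∣nQ Q∣Aδ δp∣An+p
  where
  open SpecialFactor r n p p' q q' η δ p∣r q∣r pq≡p'q' gp gq ηδpq≡rn η-nonspecial δ-special
  A = proj₁ twisting-exponent
  δp∣An+p = proj₁ (proj₂ twisting-exponent)
  Q∣Aδ = proj₂ (proj₂ twisting-exponent)
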